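{- Let $G$ be a connected graph of order at least two and let $H$ be a connected graph. Then $\mathcal{P}(G)\times V(H)\subseteq \mathcal{P}(G\Box H)$.
   Context: All graphs are finite, simple and undirected; $N_F[v]$ is the closed neighbourhood of $v$ in $F$. For a graph $F$, $\mathcal{P}(F)$ is the set of vertices $v\in V(F)$ for which there exist two vertices $u,w\in V(F)$ with $N_F[u]\cap N_F[w]=\{v\}$. The Cartesian product $G\Box H$ has vertex set $V(G)\times V(H)$, with $(x,y)$ adjacent to $(x',y')$ iff either $x=x'$ and $yy'\in E(H)$, or $xx'\in E(G)$ and $y=y'$. -}

module Defs where

open import Data.Nat using (ℕ; _≥_)
open import Data.Fin using (Fin)
open import Data.Bool using (Bool; true; false)
open import Data.Product using (_×_; _,_; Σ; ∃)
open import Data.Sum using (_⊎_)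
open import Relation.Binary.PropositionalEquality using (_≡_; _≢_)

record Graph : Set where
  field
    n     : ℕ
    adj   : Fin n → Fin n → Bool
    sym   : ∀ x y → adj x y ≡ adj y x
    irrefl : ∀ x → adj x x ≡ false
open Graph public

V : Graph → Set
V G = Fin (n G)

Adj : (G : Graph) → V G → V G → Set
Adj G x y = adj G x y ≡ true

order : Graph → ℕ
order G = n G

data Walk (G : Graph) : V G → V G → Set where
  here : ∀ {x} → Walk G x x
  step : ∀ {x y z} → Adj G x y → Walk G y z → Walk G x z

Connected : Graph → Set
Connected G = ∀ (x y : V G) → Walk G x y

InClosedNbhd : (G : Graph) → V G → V G → Set
InClosedNbhd G u x = x ≡ u ⊎ Adj G u x

InP : (G : Graph) → V G → Set
InP G v = Σ (V G) λ u → Σ (V G) λ w →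
  ∀ (x : V G) → ((InClosedNbhd G u x × InClosedNbhd G w x) → x ≡ v)
              × (x ≡ v → InClosedNbhd G u x × InClosedNbhd G w x)

-- Cartesian product; vertices of G □ H are encoded as Fin (n G * n H)
-- via the standard bijection Data.Fin.combine / remQuot.
open import Data.Nat using (_*_)
open import Data.Fin using (combine; remQuot)
open import Data.Bool using (_∧_; _∨_)
open import Data.Fin using (_≟_)
open import Relation.Nullary.Decidable using (⌊_⌋)

private
  boxAdj : (G H : Graph) → V G → V H → V G → V H → Bool
  boxAdj G H x y x' y' =
    (⌊ x ≟ x' ⌋ ∧ adj H y y') ∨ (adj G x x' ∧ ⌊ y ≟ y' ⌋)

_□_ : Graph → Graph → Graph
_□_ G H = record
  { n = n G * n H
  ; adj = λ p q → let (x , y) = remQuot (n H) p ; (x' , y') = remQuot (n H) q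
                  in boxAdj G H x y x' y'
  ; sym = symP
  ; irrefl = irrP
  }
  where
  open import Relation.Binary.PropositionalEquality using (refl; cong₂)
  open import Relation.Nullary using (yes; no)
  open import Relation.Binary.PropositionalEquality using (_≡_)
  symD : ∀ {k} (a b : Fin k) → ⌊ a ≟ b ⌋ ≡ ⌊ b ≟ a ⌋
  symD a b with a ≟ b | b ≟ a
  ... | yes _ | yes _ = refl
  ... | no _ | no _ = refl
  ... | yes refl | no ¬p = Data.Empty.⊥-elim (¬p refl) where import Data.Empty
  ... | no ¬p | yes refl = Data.Empty.⊥-elim (¬p refl) where import Data.Empty
  diag : ∀ {k} (a : Fin k) → ⌊ a ≟ a ⌋ ≡ true
  diag a with a ≟ a
  ... | yes _ = refl
  ... | no ¬p = Data.Empty.⊥-elim (¬p refl) where import Data.Empty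
  symB : ∀ x y x' y' → boxAdj G H x y x' y' ≡ boxAdj G H x' y' x y
  symB x y x' y' rewrite symD x x' | symD y y' | Graph.sym G x x' | Graph.sym H y y' = refl
  symP : ∀ p q → _
  symP p q = symB _ _ _ _
  irrB : ∀ x y → boxAdj G H x y x y ≡ false
  irrB x y rewrite diag x | diag y | irrefl G x | irrefl H y = refl
  irrP : ∀ p → _
  irrP p = irrB _ _

pair : (G H : Graph) → V G → V H → V (G □ H)
pair G H x y = combine x y

{-# OPTIONS --safe #-}
-- If u and w witness v ∈ 𝒫(G), then (u , y) and (w , y) witness (v , y) ∈ 𝒫(G □ H).
-- A common closed neighbour of them is either in the G-fibre through y, where it
-- is (v , y), or reached by an H-edge from both, which forces u ≡ w.  But u ≢ w:
-- otherwise N_G[u] = {v}, so u is isolated, impossible in a connected graph of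
-- order at least two.
module Submission where

open import Defs hiding (sym)
open import Data.Nat using (_≥_; s≤s)
open import Data.Fin using (Fin; zero; suc; _≟_)
open import Data.Fin.Properties using (remQuot-combine; combine-remQuot; combine-injectiveˡ; combine-injectiveʳ)
open import Data.Bool using (Bool; _∧_; _∨_)
open import Data.Bool.Properties using (T-≡; T-∧; T-∨)
open import Data.Product as Prod using (_×_; _,_; proj₁; proj₂; ∃)
open import Data.Sum as Sum using (_⊎_; inj₁; inj₂)
open import Data.Empty using (⊥-elim)
open import Function using (_∘_)
open import Function.Bundles using (Equivalence)
open import Relation.Nullary using (¬_)
open import Relation.Nullary.Decidable using (⌊_⌋; toWitness; fromWitness)
open import Relation.Binary.PropositionalEquality using (_≡_; _≢_; refl; sym; trans; cong; cong₂; subst)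

open Equivalence using (to; from)

Adj-irrefl : (G : Graph) {x : V G} → ¬ Adj G x x
Adj-irrefl G {x} e with trans (sym e) (irrefl G x)
... | ()

NoIsolatedVertices : Graph → Set
NoIsolatedVertices G = ∀ x → ∃ (Adj G x)

Fin-≥2⇒∃≢ : ∀ {m} → m ≥ 2 → (x : Fin m) → ∃ (_≢ x)
Fin-≥2⇒∃≢ (s≤s (s≤s _)) zero    = suc zero , λ ()
Fin-≥2⇒∃≢ (s≤s (s≤s _)) (suc _) = zero , λ ()

walk-≢⇒∃Adj : {G : Graph} {x z : V G} → Walk G x z → x ≢ z → ∃ (Adj G x)
walk-≢⇒∃Adj here           x≢x = ⊥-elim (x≢x refl)
walk-≢⇒∃Adj (step xy _) _   = _ , xy

connected⇒noIsolatedVertices : (G : Graph) → Connected G → order G ≥ 2 → NoIsolatedVertices G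
connected⇒noIsolatedVertices G conn ord x =
  let z , z≢x = Fin-≥2⇒∃≢ ord x in walk-≢⇒∃Adj (conn x z) (z≢x ∘ sym)

adj⇒closedNbhd-nonsingleton : (G : Graph) {u a v : V G} → Adj G u a →
  ¬ (∀ x → InClosedNbhd G u x → x ≡ v)
adj⇒closedNbhd-nonsingleton G {u} {a} ua N[u]⊆v
  with refl ← N[u]⊆v u (inj₁ refl)
  with refl ← N[u]⊆v a (inj₂ ua) = Adj-irrefl G ua

module _ (G H : Graph) where

  pair-injective : ∀ {x a : V G} {y b : V H} → pair G H x y ≡ pair G H a b → x ≡ a × y ≡ b
  pair-injective {x} {a} {y} {b} e = combine-injectiveˡ x y a b e , combine-injectiveʳ x y a b e

  pair-elim : {Q : V (G □ H) → Set} → (∀ a b → Q (pair G H a b)) → ∀ p → Q p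
  pair-elim {Q} f p = subst Q (combine-remQuot {n G} (n H) p) (f _ _)

  adj-pair : ∀ x y a b → adj (G □ H) (pair G H x y) (pair G H a b)
                       ≡ (⌊ x ≟ a ⌋ ∧ adj H y b) ∨ (adj G x a ∧ ⌊ y ≟ b ⌋)
  adj-pair x y a b = cong₂ box (remQuot-combine x y) (remQuot-combine a b)
    where
    box : V G × V H → V G × V H → Bool
    box (x , y) (a , b) = (⌊ x ≟ a ⌋ ∧ adj H y b) ∨ (adj G x a ∧ ⌊ y ≟ b ⌋)

  □-adj⁻ : ∀ {x y a b} → Adj (G □ H) (pair G H x y) (pair G H a b) →
           (x ≡ a × Adj H y b) ⊎ (Adj G x a × y ≡ b)
  □-adj⁻ {x} {y} {a} {b} e =
    Sum.map (Prod.map toWitness (to T-≡) ∘ to T-∧) (Prod.map (to T-≡) toWitness ∘ to T-∧)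
            (to T-∨ (from T-≡ (trans (sym (adj-pair x y a b)) e)))

  □-adjᴳ : ∀ {x a y} → Adj G x a → Adj (G □ H) (pair G H x y) (pair G H a y)
  □-adjᴳ {x} {a} {y} e =
    trans (adj-pair x y a y) (to T-≡ (from T-∨ (inj₂ (from T-∧ (from T-≡ e , fromWitness refl)))))

  □-closedNbhd⁻ : ∀ {x y a b} → InClosedNbhd (G □ H) (pair G H x y) (pair G H a b) →
                  (InClosedNbhd G x a × b ≡ y) ⊎ (x ≡ a × Adj H y b)
  □-closedNbhd⁻ (inj₁ e) with refl , refl ← pair-injective e = inj₁ (inj₁ refl , refl)
  □-closedNbhd⁻ (inj₂ e) with □-adj⁻ e
  ... | inj₁ x≡a,yb       = inj₂ x≡a,yb
  ... | inj₂ (xa , refl)  = inj₁ (inj₂ xa , refl)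

  □-closedNbhdᴳ : ∀ {x a y} → InClosedNbhd G x a → InClosedNbhd (G □ H) (pair G H x y) (pair G H a y)
  □-closedNbhdᴳ (inj₁ refl) = inj₁ refl
  □-closedNbhdᴳ (inj₂ e)    = inj₂ (□-adjᴳ e)

  InP-□ : NoIsolatedVertices G → ∀ {v y} → InP G v → InP (G □ H) (pair G H v y)
  InP-□ noIso {v} {y} (u , w , P) = pair G H u y , pair G H w y , pair-elim λ a b → common⇒vy a b , vy⇒common a b
    where
    u≢w : u ≢ w
    u≢w refl = let a , ua = noIso u in
      adj⇒closedNbhd-nonsingleton G ua λ x ux → proj₁ (P x) (ux , ux)

    common⇒vy : ∀ a b → InClosedNbhd (G □ H) (pair G H u y) (pair G H a b)
                   × InClosedNbhd (G □ H) (pair G H w y) (pair G H a b) → pair G H a b ≡ pair G H v y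
    common⇒vy a b (ua , wa) with □-closedNbhd⁻ ua | □-closedNbhd⁻ wa
    ... | inj₁ (ua' , refl) | inj₁ (wa' , _) = cong (λ t → pair G H t y) (proj₁ (P a) (ua' , wa'))
    ... | inj₁ (_ , refl)   | inj₂ (_ , yy)  = ⊥-elim (Adj-irrefl H yy)
    ... | inj₂ (_ , yy)     | inj₁ (_ , refl) = ⊥-elim (Adj-irrefl H yy)
    ... | inj₂ (refl , _)   | inj₂ (refl , _) = ⊥-elim (u≢w refl)

    vy⇒common : ∀ a b → pair G H a b ≡ pair G H v y → InClosedNbhd (G □ H) (pair G H u y) (pair G H a b)
                                                 × InClosedNbhd (G □ H) (pair G H w y) (pair G H a b)
    vy⇒common a b e with refl , refl ← pair-injective e = Prod.map □-closedNbhdᴳ □-closedNbhdᴳ (proj₂ (P v) refl)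

lemma5p2 : (G H : Graph) → Connected G → order G ≥ 2 → Connected H →
    ∀ (v : V G) (y : V H) → InP G v → InP (G □ H) (pair G H v y)
lemma5p2 G H conG ord _ v y = InP-□ G H (connected⇒noIsolatedVertices G conG ord)
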